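{- Let $G$ be a simple graph with $n$ vertices and $m$ edges, and let $\hat{G}$ be a 1-regular graph with $V(\hat{G})=E(G)$. If $m<2n$, then there exists a vertex $v$ of $G$ such that $\partial_G v$ is independent in $\hat{G}$.
   Context: For a vertex $v$ of $G$, $\partial_G v$ denotes the set of edges of $G$ incident with $v$. The graph $\hat{G}$ is called the conflict graph; a set of edges of $G$ is conflict-free if it is independent in $\hat{G}$. A graph is 1-regular if every vertex has degree exactly one. -}

module Defs where

open import Data.Nat using (ℕ; _<ᵇ_)
open import Data.Bool using (Bool; true; false; _∧_)
open import Data.Fin using (Fin; toℕ)
open import Data.List using (List; length; filterᵇ; allFin; cartesianProduct; lookup)
open import Data.Product using (_×_; _,_; proj₁; proj₂)
open import Relation.Binary.PropositionalEquality using (_≡_)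

record SimpleGraph (n : ℕ) : Set where
  field
    adj   : Fin n → Fin n → Bool
    sym   : ∀ u v → adj u v ≡ adj v u
    irrfl : ∀ v → adj v v ≡ false
open SimpleGraph public

-- The edge set E(G), as a duplicate-free list of pairs (u , v) with u < v
-- and u adjacent to v.  Each edge {u,v} appears exactly once.
edges : ∀ {n} → SimpleGraph n → List (Fin n × Fin n)
edges {n} G = filterᵇ (λ p → (toℕ (proj₁ p) <ᵇ toℕ (proj₂ p)) ∧ adj G (proj₁ p) (proj₂ p))
                      (cartesianProduct (allFin n) (allFin n))

numEdges : ∀ {n} → SimpleGraph n → ℕ
numEdges G = length (edges G)

-- the edge of G with index e (edges are identified with Fin (numEdges G))
edgeAt : ∀ {n} (G : SimpleGraph n) → Fin (numEdges G) → Fin n × Fin n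
edgeAt G e = lookup (edges G) e

degree : ∀ {k} → SimpleGraph k → Fin k → ℕ
degree {k} H v = length (filterᵇ (adj H v) (allFin k))

OneRegular : ∀ {k} → SimpleGraph k → Set
OneRegular H = ∀ v → degree H v ≡ 1

_∈∂_ : ∀ {n} {G : SimpleGraph n} → Fin (numEdges G) → Fin n → Set
_∈∂_ {G = G} e v = (proj₁ (edgeAt G e) ≡ v) Data.Sum.⊎ (proj₂ (edgeAt G e) ≡ v)
  where import Data.Sum

IndependentStar : ∀ {n} (G : SimpleGraph n) → SimpleGraph (numEdges G) → Fin n → Set
IndependentStar G Ĝ v =
  ∀ e f → _∈∂_ {G = G} e v → _∈∂_ {G = G} f v → adj Ĝ e f ≡ false

-- Suppose every vertex v sees a conflict: two edges e_v, f_v at v that are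
-- adjacent in Ĝ.  Since Ĝ is 1-regular, f_v is the unique Ĝ-neighbour of
-- e_v, and two distinct edges of a simple graph share at most one endpoint,
-- so the conflicting pair {e_v, f_v} determines v.  Hence the 2n edges
-- e_v, f_v are pairwise distinct, and m ≥ 2n.
module Submission where

open import Defs
open import Data.Nat using (ℕ; _<_; _*_)
open import Data.Product using (∃)

open import Data.Nat using (_≤_)
open import Data.Bool using (true; T)
open import Data.Bool.Properties using (¬-not; T-∧) renaming (_≟_ to _≟ᵇ_)
open import Data.Fin using (Fin; zero; suc; toℕ; remQuot; combine; _≟_)
open import Data.Fin.Properties using (any?; ¬∀⟶∃¬; injective⇒≤; combine-remQuot)
open import Data.List using (List; []; _∷_; length; lookup; filterᵇ; allFin; cartesianProduct)
open import Data.List.Membership.Propositional using (_∈_)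
open import Data.List.Membership.Propositional.Properties
  using (∈-filter⁺; ∈-filter⁻; ∈-lookup; ∈-allFin)
open import Data.List.Relation.Unary.All as All using ()
open import Data.List.Relation.Unary.AllPairs using (_∷_)
open import Data.List.Relation.Unary.Any using (here)
open import Data.List.Relation.Unary.Unique.Propositional using (Unique)
import Data.List.Relation.Unary.Unique.Propositional.Properties as Unique
open import Data.Nat.Properties using (<ᵇ⇒<; <-asym; <⇒≱)
open import Data.Product using (_×_; _,_; proj₁; proj₂; uncurry)
open import Data.Sum using (_⊎_; inj₁; inj₂)
open import Function using (Injective; _∘_)
open import Function.Bundles using (Equivalence)
open import Relation.Binary.PropositionalEquality
  using (_≡_; _≢_; refl; cong; subst; trans; module ≡-Reasoning) renaming (sym to ≡-sym)
open import Relation.Nullary using (Dec; yes; no; ¬_; contradiction; T?)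
open import Relation.Nullary.Decidable using (_×-dec_; _⊎-dec_; map′)

lookup-injective : ∀ {A : Set} {xs : List A} → Unique xs →
                   ∀ i j → lookup xs i ≡ lookup xs j → i ≡ j
lookup-injective (_ ∷ _)  zero    zero    _  = refl
lookup-injective (x∉ ∷ _) zero    (suc j) eq = contradiction eq (All.lookup x∉ (∈-lookup j))
lookup-injective (x∉ ∷ _) (suc i) zero    eq = contradiction (≡-sym eq) (All.lookup x∉ (∈-lookup i))
lookup-injective (_ ∷ u)  (suc i) (suc j) eq = cong suc (lookup-injective u i j eq)

∈-length≡1⇒≡ : ∀ {A : Set} {xs : List A} {x y : A} → length xs ≡ 1 → x ∈ xs → y ∈ xs → x ≡ y
∈-length≡1⇒≡ {xs = _ ∷ []} _ (here refl) (here refl) = refl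

remQuot-injective : ∀ {m} n → Injective _≡_ _≡_ (remQuot {m} n)
remQuot-injective {m} n {i} {j} eq = begin
  i                                  ≡⟨ combine-remQuot {m} n i ⟨
  uncurry combine (remQuot {m} n i)  ≡⟨ cong (uncurry combine) eq ⟩
  uncurry combine (remQuot {m} n j)  ≡⟨ combine-remQuot {m} n j ⟩
  j                                  ∎
  where open ≡-Reasoning

Incident : ∀ {n} → Fin n × Fin n → Fin n → Set
Incident (a , b) v = a ≡ v ⊎ b ≡ v

Increasing : ∀ {n} → Fin n × Fin n → Set
Increasing (a , b) = toℕ a < toℕ b

adj-functional : ∀ {k} (H : SimpleGraph k) → OneRegular H →
                 ∀ {e f f′} → adj H e f ≡ true → adj H e f′ ≡ true → f ≡ f′
adj-functional {k} H reg {e} {f} {f′} ef ef′ =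
  ∈-length≡1⇒≡ (reg e) (neighbour ef) (neighbour ef′)
  where
  neighbour : ∀ {g} → adj H e g ≡ true → g ∈ filterᵇ (adj H e) (allFin k)
  neighbour {g} eg = ∈-filter⁺ (T? ∘ adj H e) (∈-allFin g) (subst T (≡-sym eg) _)

adj-partner-closed : ∀ {k} (H : SimpleGraph k) → OneRegular H →
  ∀ {e f e′ f′} → adj H e f ≡ true → adj H e′ f′ ≡ true →
  Incident (e′ , f′) e → Incident (e′ , f′) f
adj-partner-closed H reg ef ef′ (inj₁ refl) = inj₂ (adj-functional H reg ef′ ef)
adj-partner-closed H reg {e} {e′ = e′} ef ef′ (inj₂ refl) =
  inj₁ (adj-functional H reg (trans (sym H e e′) ef′) ef)

adj⇒≢ : ∀ {k} (H : SimpleGraph k) {e f} → adj H e f ≡ true → e ≢ f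
adj⇒≢ H {e} ef refl with () ← trans (≡-sym ef) (irrfl H e)

incident-both : ∀ {n} {v w : Fin n} (p : Fin n × Fin n) → v ≢ w →
                Incident p v → Incident p w → p ≡ (v , w) ⊎ p ≡ (w , v)
incident-both _ v≢w (inj₁ refl) (inj₁ refl) = contradiction refl v≢w
incident-both _ v≢w (inj₁ refl) (inj₂ refl) = inj₁ refl
incident-both _ v≢w (inj₂ refl) (inj₁ refl) = inj₂ refl
incident-both _ v≢w (inj₂ refl) (inj₂ refl) = contradiction refl v≢w

increasing-incident-unique : ∀ {n} {v w : Fin n} {p q : Fin n × Fin n} → v ≢ w →
  Increasing p → Increasing q →
  Incident p v → Incident p w → Incident q v → Incident q w → p ≡ q
increasing-incident-unique {p = p} {q} v≢w p↑ q↑ pv pw qv qw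
  with incident-both p v≢w pv pw | incident-both q v≢w qv qw
... | inj₁ refl | inj₁ refl = refl
... | inj₂ refl | inj₂ refl = refl
... | inj₁ refl | inj₂ refl = contradiction q↑ (<-asym p↑)
... | inj₂ refl | inj₁ refl = contradiction q↑ (<-asym p↑)

module _ {n} (G : SimpleGraph n) where

  edgeAt-increasing : ∀ e → Increasing (edgeAt G e)
  edgeAt-increasing e = <ᵇ⇒< _ _ (proj₁ (Equivalence.to T-∧ (proj₂ listed)))
    where
    listed = ∈-filter⁻ (λ p → T? _) {xs = cartesianProduct (allFin n) (allFin n)}
                       (∈-lookup {xs = edges G} e)

  edgeAt-injective : Injective _≡_ _≡_ (edgeAt G)
  edgeAt-injective = lookup-injective
    (Unique.filter⁺ _ (Unique.cartesianProduct⁺ (Unique.allFin⁺ n) (Unique.allFin⁺ n))) _ _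

  shared-endpoints⇒≡ : ∀ {e f v w} → e ≢ f →
    Incident (edgeAt G e) v → Incident (edgeAt G f) v →
    Incident (edgeAt G e) w → Incident (edgeAt G f) w → v ≡ w
  shared-endpoints⇒≡ {e} {f} {v} {w} e≢f ev fv ew fw with v ≟ w
  ... | yes v≡w = v≡w
  ... | no  v≢w = contradiction (edgeAt-injective (increasing-incident-unique v≢w
          (edgeAt-increasing e) (edgeAt-increasing f) ev ew fv fw)) e≢f

module _ {n} (G : SimpleGraph n) (Ĝ : SimpleGraph (numEdges G)) where

  record Conflict (v : Fin n) : Set where
    constructor conflict
    field
      {e f}       : Fin (numEdges G)
      e∈∂v        : Incident (edgeAt G e) v
      f∈∂v        : Incident (edgeAt G f) v
      conflicting : adj Ĝ e f ≡ true

  incident? : ∀ e v → Dec (Incident (edgeAt G e) v)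
  incident? e v = (proj₁ (edgeAt G e) ≟ v) ⊎-dec (proj₂ (edgeAt G e) ≟ v)

  conflict? : ∀ v → Dec (Conflict v)
  conflict? v = map′ (λ (_ , _ , ev , fv , ef) → conflict ev fv ef)
                     (λ (conflict ev fv ef) → _ , _ , ev , fv , ef)
    (any? λ e → any? λ f → incident? e v ×-dec incident? f v ×-dec (adj Ĝ e f ≟ᵇ true))

  conflict-free⇒independent : ∀ {v} → ¬ Conflict v → IndependentStar G Ĝ v
  conflict-free⇒independent free e f ev fv = ¬-not λ ef → free (conflict ev fv ef)

  module _ (reg : OneRegular Ĝ) (conflictAt : ∀ v → Conflict v) where

    -- pair v is an edge of Ĝ, so Incident (pair v) e says that e is one of its members.
    pair : Fin n → Fin (numEdges G) × Fin (numEdges G)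
    pair v = Conflict.e (conflictAt v) , Conflict.f (conflictAt v)

    pair-incident : ∀ {v e} → Incident (pair v) e → Incident (edgeAt G e) v
    pair-incident {v} (inj₁ refl) = Conflict.e∈∂v (conflictAt v)
    pair-incident {v} (inj₂ refl) = Conflict.f∈∂v (conflictAt v)

    pair-adj : ∀ v → adj Ĝ (proj₁ (pair v)) (proj₂ (pair v)) ≡ true
    pair-adj v = Conflict.conflicting (conflictAt v)

    pair-adj˘ : ∀ v → adj Ĝ (proj₂ (pair v)) (proj₁ (pair v)) ≡ true
    pair-adj˘ v = trans (sym Ĝ (proj₂ (pair v)) (proj₁ (pair v))) (pair-adj v)

    pair-≢ : ∀ v → proj₁ (pair v) ≢ proj₂ (pair v)
    pair-≢ v = adj⇒≢ Ĝ (pair-adj v)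

    -- One shared member forces, by 1-regularity, pair v ⊆ pair w; these two
    -- distinct edges of G are then incident with both v and w.
    shared-member⇒≡ : ∀ {v w e} → Incident (pair v) e → Incident (pair w) e → v ≡ w
    shared-member⇒≡ {v} {w} {e} e∈v e∈w = shared-endpoints⇒≡ G (pair-≢ v)
      (pair-incident {v} (inj₁ refl)) (pair-incident {v} (inj₂ refl))
      (pair-incident (first∈w e∈v e∈w)) (pair-incident (second∈w e∈v e∈w))
      where
      first∈w : Incident (pair v) e → Incident (pair w) e → Incident (pair w) (proj₁ (pair v))
      first∈w (inj₁ refl) e∈w = e∈w
      first∈w (inj₂ refl) e∈w = adj-partner-closed Ĝ reg (pair-adj˘ v) (pair-adj w) e∈w
      second∈w : Incident (pair v) e → Incident (pair w) e → Incident (pair w) (proj₂ (pair v))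
      second∈w (inj₁ refl) e∈w = adj-partner-closed Ĝ reg (pair-adj v) (pair-adj w) e∈w
      second∈w (inj₂ refl) e∈w = e∈w

    pick : Fin 2 × Fin n → Fin (numEdges G)
    pick (zero , v)     = proj₁ (pair v)
    pick (suc zero , v) = proj₂ (pair v)

    pick∈pair : ∀ b v → Incident (pair v) (pick (b , v))
    pick∈pair zero       v = inj₁ refl
    pick∈pair (suc zero) v = inj₂ refl

    pick-injective-at : ∀ v {b c} → pick (b , v) ≡ pick (c , v) → b ≡ c
    pick-injective-at v {zero}     {zero}     _  = refl
    pick-injective-at v {zero}     {suc zero} eq = contradiction eq (pair-≢ v)
    pick-injective-at v {suc zero} {zero}     eq = contradiction (≡-sym eq) (pair-≢ v)
    pick-injective-at v {suc zero} {suc zero} _  = refl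

    pick-injective : Injective _≡_ _≡_ pick
    pick-injective {b , v} {c , w} eq
      with refl ← shared-member⇒≡ (pick∈pair b v)
                    (subst (Incident (pair w)) (≡-sym eq) (pick∈pair c w))
      = cong (_, v) (pick-injective-at v eq)

    everywhere-conflict⇒2n≤m : 2 * n ≤ numEdges G
    everywhere-conflict⇒2n≤m = injective⇒≤ {f = pick ∘ remQuot n} λ eq →
      remQuot-injective n (pick-injective eq)

proposition9 : (n : ℕ) (G : SimpleGraph n) (Ĝ : SimpleGraph (numEdges G)) →
               OneRegular Ĝ → numEdges G < 2 * n →
               ∃ λ v → IndependentStar G Ĝ v
proposition9 n G Ĝ reg m<2n =
  let v , free = ¬∀⟶∃¬ n (Conflict G Ĝ) (conflict? G Ĝ)
                   (λ conflictAt → <⇒≱ m<2n (everywhere-conflict⇒2n≤m G Ĝ reg conflictAt))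
  in v , conflict-free⇒independent G Ĝ free
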